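{- Given an $I/O$ probabilistic transducer $\mathcal{T}$ with $I=\{i_1,\ldots,i_k\}$, $O=\{o_1,\ldots,o_k\}$, and a permutation $\pi\in\mathcal{S}_k$, one can construct two probabilistic reward automata $\mathcal{A},\mathcal{B}$ over the alphabet $2^I$ with reward functions of dimension $k=|I|$, such that for every $x\in(2^I)^+$ and every $\vec a\in\mathbb{N}^k$, $\Pr(\mathcal{A}(x)=\vec a)=\Pr(\mathfrak{P}(\mathcal{T}(x))=\vec a)$ and $\Pr(\mathcal{B}(x)=\vec a)=\Pr(\mathfrak{P}(\mathcal{T}(\pi(x)))=\pi(\vec a))$.
   Context: An $I/O$ probabilistic transducer is $\mathcal{T}=\langle I,O,S,s_0,\delta,\ell\rangle$ with $S$ a finite set of states, $s_0\in S$ initial, $\delta:S\times 2^I\to\Delta(S)$ a probabilistic transition function, and $\ell:S\to 2^O$ a labelling. For $x=\vec i_1\cdots\vec i_n\in(2^I)^+$, a run is $q_0,\ldots,q_n$ with $q_0=s_0$, of probability $\prod_{j=0}^{n-1}\delta(q_j,\vec i_{j+1})(q_{j+1})$, and output $\ell(q_1)\cdots\ell(q_n)$; $\Pr(\mathcal{T}(x)=y)$ is the total probability of runs on $x$ with output $y$. For $\pi\in\mathcal{S}_k$, $\pi(\{i_{j_1},\ldots,i_{j_m}\})=\{i_{\pi(j_1)},\ldots,i_{\pi(j_m)}\}$, extended letter-wise to words. For $y=\vec o_1\cdots\vec o_n\in(2^O)^+$, its Parikh image is $\mathfrak{P}(y)=(\#(y,1),\ldots,\#(y,k))\in\mathbb{N}^k$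 where $\#(y,j)=|\{m: o_j\in\vec o_m\}|$, and $\Pr(\mathfrak{P}(\mathcal{T}(x))=\vec a)=\sum_{y:\mathfrak{P}(y)=\vec a}\Pr(\mathcal{T}(x)=y)$. For $\vec a=(a_1,\ldots,a_k)$, $\pi(\vec a)=(a_{\pi^{ -1}(1)},\ldots,a_{\pi^{ -1}(k)})$. A probabilistic reward automaton (PRA) is a probabilistic automaton $\langle Q,\Sigma,\delta,q_0,F\rangle$ ($Q$ finite, $\delta:Q\times\Sigma\to\Delta(Q)$, $q_0\in Q$, $F\subseteq Q$) together with a reward function $\mathsf{R}:Q\to\{0,1\}^k$; the reward of a run $q_0,q_1,\ldots,q_n$ on a word of length $n$ is $\sum_{j=1}^{n}\mathsf{R}(q_j)$, and $\mathcal{A}(w)$ denotes the distribution of reward vectors in $\mathbb{N}^k$ induced by the runs of $\mathcal{A}$ on $w$ weighted by their probabilities.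
   Formalization: The transducer 𝒯 has rational transition probabilities rather than real ones, and the constructed automata 𝒜, ℬ likewise have transition probabilities taken in ℚ. -}

module Defs where

open import Data.Nat using (ℕ; zero; suc)
import Data.Nat as ℕ
open import Data.Bool using (Bool; true; false; if_then_else_)
import Data.Bool as 𝔹
open import Data.Fin using (Fin)
open import Data.Fin.Subset using (Subset)
open import Data.Fin.Permutation using (Permutation′; _⟨$⟩ˡ_)
open import Data.List using (List; []; _∷_; [_]; map; concatMap; foldr; allFin)
open import Data.Vec using (Vec; []; _∷_; lookup; tabulate; replicate; zipWith)
import Data.Vec as V
open import Data.Vec.Properties using (≡-dec)
open import Data.Rational using (ℚ; 0ℚ; 1ℚ; _+_; _*_; _≤_)
import Data.Rational.Properties as ℚP
open import Relation.Nullary.Decidable using (⌊_⌋)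
open import Relation.Binary.PropositionalEquality using (_≡_)

sumℚ : List ℚ → ℚ
sumℚ = foldr _+_ 0ℚ

ΣFin : (n : ℕ) → (Fin n → ℚ) → ℚ
ΣFin n f = sumℚ (map f (allFin n))

allVec : {A : Set} → List A → (m : ℕ) → List (Vec A m)
allVec xs zero = [ [] ]
allVec xs (suc m) = concatMap (λ a → map (a ∷_) (allVec xs m)) xs

allSubsets : (k : ℕ) → List (Subset k)
allSubsets k = allVec (true ∷ false ∷ []) k

record Dist (n : ℕ) : Set where
  field
    prob    : Fin n → ℚ
    nonneg  : ∀ q → 0ℚ ≤ prob q
    sumOne  : ΣFin n prob ≡ 1ℚ

open Dist public

-- I/O probabilistic transducer with I = {i_1..i_k}, O = {o_1..o_k}, both ≅ Fin k;
-- letters of 2^I and 2^O are Subset k; states S = Fin nS.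
record Transducer (k : ℕ) : Set where
  field
    nS : ℕ
    s₀ : Fin nS
    δ  : Fin nS → Subset k → Dist nS
    ℓ  : Fin nS → Subset k

-- probabilistic reward automaton over alphabet 2^I with reward dimension k;
-- R : Q → {0,1}^k represented as a Bool-vector (a Subset k).
record PRA (k : ℕ) : Set where
  field
    nQ : ℕ
    δ  : Fin nQ → Subset k → Dist nQ
    q₀ : Fin nQ
    F  : Subset nQ
    R  : Fin nQ → Subset k

Word : ℕ → ℕ → Set
Word k n = Vec (Subset k) n

-- probability of the run q, q₁..qₙ on letters i₁..iₙ (q₀ given separately)
runProb : {k nS : ℕ} → (Fin nS → Subset k → Dist nS) →
          Fin nS → {n : ℕ} → Word k n → Vec (Fin nS) n → ℚ
runProb δ q [] [] = 1ℚ
runProb δ q (i ∷ x) (q′ ∷ qs) = prob (δ q i) q′ * runProb δ q′ x qs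

indicator : Bool → ℚ
indicator b = if b then 1ℚ else 0ℚ

_≟W_ : {k n : ℕ} → Word k n → Word k n → Bool
u ≟W v = ⌊ ≡-dec (≡-dec 𝔹._≟_) u v ⌋

_≟ℕv_ : {k : ℕ} → Vec ℕ k → Vec ℕ k → Bool
u ≟ℕv v = ⌊ ≡-dec ℕ._≟_ u v ⌋

toVec01 : {k : ℕ} → Subset k → Vec ℕ k
toVec01 = V.map (λ b → if b then 1 else 0)

parikh : {k n : ℕ} → Word k n → Vec ℕ k
parikh {k} [] = replicate k 0
parikh (o ∷ y) = zipWith ℕ._+_ (toVec01 o) (parikh y)

-- Pr(T(x) = y) for |y| = |x| (outputs of other lengths have probability 0)
PrOut : {k : ℕ} (T : Transducer k) {n : ℕ} → Word k n → Word k n → ℚ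
PrOut T {n} x y =
  sumℚ (map (λ qs → runProb δ s₀ x qs * indicator (V.map ℓ qs ≟W y))
            (allVec (allFin nS) n))
  where open Transducer T

PrParikh : {k : ℕ} (T : Transducer k) {n : ℕ} → Word k n → Vec ℕ k → ℚ
PrParikh {k} T {n} x a =
  sumℚ (map (λ y → indicator (parikh y ≟ℕv a) * PrOut T x y)
            (allVec (allSubsets k) n))

reward : {k nQ n : ℕ} → (Fin nQ → Subset k) → Vec (Fin nQ) n → Vec ℕ k
reward {k} R [] = replicate k 0
reward R (q ∷ qs) = zipWith ℕ._+_ (toVec01 (R q)) (reward R qs)

PrReward : {k : ℕ} (A : PRA k) {n : ℕ} → Word k n → Vec ℕ k → ℚ
PrReward A {n} x a =
  sumℚ (map (λ qs → runProb δ q₀ x qs * indicator (reward R qs ≟ℕv a))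
            (allVec (allFin nQ) n))
  where open PRA A

-- π({i_j1..i_jm}) = {i_π(j1)..i_π(jm)}: m ∈ π(S) iff π⁻¹(m) ∈ S
permSet : {k : ℕ} → Permutation′ k → Subset k → Subset k
permSet π S = tabulate (λ m → lookup S (π ⟨$⟩ˡ m))

permWord : {k n : ℕ} → Permutation′ k → Word k n → Word k n
permWord π = V.map (permSet π)

permVec : {k : ℕ} → Permutation′ k → Vec ℕ k → Vec ℕ k
permVec π a = tabulate (λ m → lookup a (π ⟨$⟩ˡ m))

-- A run of T has exactly one output word, so summing Pr(T(x) = y) over all y with
-- 𝔓(y) = a collapses to a sum over runs whose output has Parikh image a.  Reading
-- the labelling of T as a reward, the reward of a run is the Parikh image of its
-- output, so T itself, viewed as a PRA, is A.  For B, the automaton reads x but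
-- moves as T does on π(x), and its reward is the labelling relabelled by π⁻¹; then
-- π(reward) is the Parikh image of the output, and π is injective on ℕᵏ.
module Submission where

open import Defs
open import Data.Nat using (ℕ; suc; zero)
import Data.Nat as ℕ
open import Data.Bool using (Bool; true; false; _∧_)
import Data.Bool as 𝔹
open import Data.Fin using (Fin)
open import Data.Fin.Subset using (Subset; ⊥)
open import Data.Fin.Permutation using (Permutation′; _⟨$⟩ˡ_; _⟨$⟩ʳ_; inverseʳ; inverseˡ)
open import Data.List using (List; []; _∷_; map; concatMap; _++_; allFin)
open import Data.Vec using (Vec; []; _∷_; lookup; tabulate; replicate; zipWith)
import Data.Vec as V
open import Data.Vec.Properties using (≡-dec; lookup-map; lookup-zipWith; lookup-replicate; lookup∘tabulate)
open import Data.Vec.Relation.Binary.Pointwise.Extensional using (ext; Pointwise-≡⇒≡)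
open import Data.Product using (Σ; _×_; _,_)
open import Data.Rational using (ℚ; 0ℚ; 1ℚ; _+_; _*_)
open import Data.Rational.Properties
  using (+-identityˡ; +-identityʳ; +-assoc; *-identityˡ; *-identityʳ; *-zeroˡ; *-zeroʳ;
         *-comm; *-assoc; *-distribˡ-+; +-0-commutativeMonoid; *-1-commutativeMonoid)
open import Algebra.Bundles using (CommutativeMonoid)
import Algebra.Properties.CommutativeSemigroup as CommSemigroupProperties
open import Function using (mk⇔)
open import Relation.Nullary.Decidable using (yes; no; ⌊_⌋; does; isYes≗does; does-⇔)
open import Relation.Binary.Definitions using (DecidableEquality)
open import Relation.Binary.PropositionalEquality
open ≡-Reasoning

open CommSemigroupProperties (CommutativeMonoid.commutativeSemigroup +-0-commutativeMonoid)
  using () renaming (interchange to +-interchange)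
open CommSemigroupProperties (CommutativeMonoid.commutativeSemigroup *-1-commutativeMonoid)
  using () renaming (x∙yz≈y∙xz to *-leftSwap)

private variable A B : Set

∑ : List A → (A → ℚ) → ℚ
∑ xs f = sumℚ (map f xs)

syntax ∑ xs (λ x → e) = ∑[ x ∈ xs ] e

∑-cong : {f g : A → ℚ} (xs : List A) → (∀ x → f x ≡ g x) → ∑ xs f ≡ ∑ xs g
∑-cong []       f≗g = refl
∑-cong (x ∷ xs) f≗g = cong₂ _+_ (f≗g x) (∑-cong xs f≗g)

∑-++ : (f : A → ℚ) (xs ys : List A) → ∑ (xs ++ ys) f ≡ ∑ xs f + ∑ ys f
∑-++ f []       ys = sym (+-identityˡ _)
∑-++ f (x ∷ xs) ys = trans (cong (f x +_) (∑-++ f xs ys)) (sym (+-assoc (f x) _ _))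

∑-zero : (xs : List A) → ∑[ x ∈ xs ] 0ℚ ≡ 0ℚ
∑-zero []       = refl
∑-zero (x ∷ xs) = trans (+-identityˡ _) (∑-zero xs)

∑-+ : (f g : A → ℚ) (xs : List A) → ∑[ x ∈ xs ] (f x + g x) ≡ ∑ xs f + ∑ xs g
∑-+ f g []       = sym (+-identityˡ 0ℚ)
∑-+ f g (x ∷ xs) =
  trans (cong (f x + g x +_) (∑-+ f g xs)) (+-interchange (f x) (g x) (∑ xs f) (∑ xs g))

*-distribˡ-∑ : (c : ℚ) (f : A → ℚ) (xs : List A) → c * ∑ xs f ≡ ∑[ x ∈ xs ] (c * f x)
*-distribˡ-∑ c f []       = *-zeroʳ c
*-distribˡ-∑ c f (x ∷ xs) =
  trans (*-distribˡ-+ c (f x) (∑ xs f)) (cong (c * f x +_) (*-distribˡ-∑ c f xs))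

*-distribʳ-∑ : (c : ℚ) (f : A → ℚ) (xs : List A) → ∑[ x ∈ xs ] (f x * c) ≡ ∑ xs f * c
*-distribʳ-∑ c f xs = begin
  ∑[ x ∈ xs ] (f x * c) ≡⟨ ∑-cong xs (λ x → *-comm (f x) c) ⟩
  ∑[ x ∈ xs ] (c * f x) ≡⟨ *-distribˡ-∑ c f xs ⟨
  c * ∑ xs f            ≡⟨ *-comm c (∑ xs f) ⟩
  ∑ xs f * c            ∎

∑-allVec-suc : (xs : List A) (n : ℕ) (f : Vec A (suc n) → ℚ) →
               ∑ (allVec xs (suc n)) f ≡ ∑[ a ∈ xs ] ∑[ v ∈ allVec xs n ] f (a ∷ v)
∑-allVec-suc xs n f = ∑-concatMap xs
  where
  ∑-map : ∀ a vs → ∑ (map (a ∷_) vs) f ≡ ∑[ v ∈ vs ] f (a ∷ v)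
  ∑-map a []       = refl
  ∑-map a (v ∷ vs) = cong (f (a ∷ v) +_) (∑-map a vs)

  ∑-concatMap : ∀ as → ∑ (concatMap (λ a → map (a ∷_) (allVec xs n)) as) f
                       ≡ ∑[ a ∈ as ] ∑[ v ∈ allVec xs n ] f (a ∷ v)
  ∑-concatMap []       = refl
  ∑-concatMap (a ∷ as) = trans (∑-++ f (map (a ∷_) (allVec xs n)) _)
                               (cong₂ _+_ (∑-map a (allVec xs n)) (∑-concatMap as))

∑-comm : (h : A → B → ℚ) (xs : List A) (ys : List B) →
         ∑[ x ∈ xs ] ∑[ y ∈ ys ] h x y ≡ ∑[ y ∈ ys ] ∑[ x ∈ xs ] h x y
∑-comm h []       ys = sym (∑-zero ys)
∑-comm h (x ∷ xs) ys = trans (cong (∑ ys (h x) +_) (∑-comm h xs ys))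
                             (sym (∑-+ (h x) (λ y → ∑[ x′ ∈ xs ] h x′ y) ys))

indicator-∧ : ∀ p q → indicator (p ∧ q) ≡ indicator p * indicator q
indicator-∧ true  true  = sym (*-identityˡ 1ℚ)
indicator-∧ true  false = sym (*-identityˡ 0ℚ)
indicator-∧ false q     = sym (*-zeroˡ (indicator q))

module _ {A : Set} (_≟_ : DecidableEquality A) where

  isYes-≡-dec-∷ : ∀ {n} (c b : A) (z y : Vec A n) →
    ⌊ ≡-dec _≟_ (c ∷ z) (b ∷ y) ⌋ ≡ ⌊ c ≟ b ⌋ ∧ ⌊ ≡-dec _≟_ z y ⌋
  isYes-≡-dec-∷ c b z y with c ≟ b | ≡-dec _≟_ z y
  ... | yes _ | yes _ = refl
  ... | yes _ | no _  = refl
  ... | no _  | _     = refl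

-- Holds when xs lists every element of A exactly once.
Sifts : {A : Set} → DecidableEquality A → List A → Set
Sifts {A} _≟_ xs = ∀ (f : A → ℚ) c → ∑[ b ∈ xs ] (f b * indicator ⌊ c ≟ b ⌋) ≡ f c

allVec-sifts : {A : Set} (_≟_ : DecidableEquality A) {xs : List A} →
               Sifts _≟_ xs → (n : ℕ) → Sifts (≡-dec _≟_) (allVec xs n)
allVec-sifts _≟_ sifts zero f [] = trans (+-identityʳ _) (*-identityʳ _)
allVec-sifts _≟_ {xs} sifts (suc n) f (c ∷ z) = begin
  ∑[ v ∈ allVec xs (suc n) ] (f v * indicator ⌊ ≡-dec _≟_ (c ∷ z) v ⌋)
    ≡⟨ ∑-allVec-suc xs n _ ⟩
  ∑[ b ∈ xs ] ∑[ y ∈ allVec xs n ] (f (b ∷ y) * indicator ⌊ ≡-dec _≟_ (c ∷ z) (b ∷ y) ⌋)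
    ≡⟨ ∑-cong xs (λ b → ∑-cong (allVec xs n) (split b)) ⟩
  ∑[ b ∈ xs ] ∑[ y ∈ allVec xs n ] (f (b ∷ y) * indicator ⌊ ≡-dec _≟_ z y ⌋ * indicator ⌊ c ≟ b ⌋)
    ≡⟨ ∑-cong xs (λ b → *-distribʳ-∑ _ _ (allVec xs n)) ⟩
  ∑[ b ∈ xs ] (∑[ y ∈ allVec xs n ] (f (b ∷ y) * indicator ⌊ ≡-dec _≟_ z y ⌋) * indicator ⌊ c ≟ b ⌋)
    ≡⟨ ∑-cong xs (λ b → cong (_* indicator ⌊ c ≟ b ⌋) (allVec-sifts _≟_ sifts n (λ y → f (b ∷ y)) z)) ⟩
  ∑[ b ∈ xs ] (f (b ∷ z) * indicator ⌊ c ≟ b ⌋)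
    ≡⟨ sifts (λ b → f (b ∷ z)) c ⟩
  f (c ∷ z) ∎
  where
  split : ∀ b y → f (b ∷ y) * indicator ⌊ ≡-dec _≟_ (c ∷ z) (b ∷ y) ⌋
                ≡ f (b ∷ y) * indicator ⌊ ≡-dec _≟_ z y ⌋ * indicator ⌊ c ≟ b ⌋
  split b y = begin
    f (b ∷ y) * indicator ⌊ ≡-dec _≟_ (c ∷ z) (b ∷ y) ⌋
      ≡⟨ cong (λ t → f (b ∷ y) * indicator t) (isYes-≡-dec-∷ _≟_ c b z y) ⟩
    f (b ∷ y) * indicator (⌊ c ≟ b ⌋ ∧ ⌊ ≡-dec _≟_ z y ⌋)
      ≡⟨ cong (f (b ∷ y) *_) (indicator-∧ ⌊ c ≟ b ⌋ ⌊ ≡-dec _≟_ z y ⌋) ⟩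
    f (b ∷ y) * (indicator ⌊ c ≟ b ⌋ * indicator ⌊ ≡-dec _≟_ z y ⌋)
      ≡⟨ cong (f (b ∷ y) *_) (*-comm (indicator ⌊ c ≟ b ⌋) _) ⟩
    f (b ∷ y) * (indicator ⌊ ≡-dec _≟_ z y ⌋ * indicator ⌊ c ≟ b ⌋)
      ≡⟨ *-assoc (f (b ∷ y)) _ _ ⟨
    f (b ∷ y) * indicator ⌊ ≡-dec _≟_ z y ⌋ * indicator ⌊ c ≟ b ⌋ ∎

bools-sift : Sifts 𝔹._≟_ (true ∷ false ∷ [])
bools-sift f true = begin
  f true * 1ℚ + (f false * 0ℚ + 0ℚ)
    ≡⟨ cong₂ _+_ (*-identityʳ (f true)) (trans (+-identityʳ _) (*-zeroʳ (f false))) ⟩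
  f true + 0ℚ
    ≡⟨ +-identityʳ (f true) ⟩
  f true ∎
bools-sift f false = begin
  f true * 0ℚ + (f false * 1ℚ + 0ℚ)
    ≡⟨ cong₂ _+_ (*-zeroʳ (f true)) (trans (+-identityʳ _) (*-identityʳ (f false))) ⟩
  0ℚ + f false
    ≡⟨ +-identityˡ (f false) ⟩
  f false ∎

words-sift : (k n : ℕ) → Sifts (≡-dec (≡-dec 𝔹._≟_)) (allVec (allSubsets k) n)
words-sift k = allVec-sifts (≡-dec 𝔹._≟_) (allVec-sifts 𝔹._≟_ bools-sift k)

PrParikh≡∑-runs : ∀ {k} (T : Transducer k) {n} (x : Word k n) (a : Vec ℕ k) →
  let open Transducer T in
  PrParikh T x a ≡ ∑[ qs ∈ allVec (allFin nS) n ]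
                     (runProb δ s₀ x qs * indicator (parikh (V.map ℓ qs) ≟ℕv a))
PrParikh≡∑-runs {k} T {n} x a = begin
  ∑[ y ∈ words ] (P y * ∑[ qs ∈ runs ] (p qs * output qs y))
    ≡⟨ ∑-cong words (λ y → *-distribˡ-∑ (P y) _ runs) ⟩
  ∑[ y ∈ words ] ∑[ qs ∈ runs ] (P y * (p qs * output qs y))
    ≡⟨ ∑-comm (λ y qs → P y * (p qs * output qs y)) words runs ⟩
  ∑[ qs ∈ runs ] ∑[ y ∈ words ] (P y * (p qs * output qs y))
    ≡⟨ ∑-cong runs (λ qs → ∑-cong words (λ y → *-leftSwap (P y) (p qs) _)) ⟩
  ∑[ qs ∈ runs ] ∑[ y ∈ words ] (p qs * (P y * output qs y))
    ≡⟨ ∑-cong runs (λ qs → *-distribˡ-∑ (p qs) _ words) ⟨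
  ∑[ qs ∈ runs ] (p qs * ∑[ y ∈ words ] (P y * output qs y))
    ≡⟨ ∑-cong runs (λ qs → cong (p qs *_) (words-sift k n P (V.map ℓ qs))) ⟩
  ∑[ qs ∈ runs ] (p qs * P (V.map ℓ qs)) ∎
  where
  open Transducer T
  words = allVec (allSubsets k) n
  runs  = allVec (allFin nS) n
  P : Word k n → ℚ
  P y = indicator (parikh y ≟ℕv a)
  p : Vec (Fin nS) n → ℚ
  p qs = runProb δ s₀ x qs
  output : Vec (Fin nS) n → Word k n → ℚ
  output qs y = indicator (V.map ℓ qs ≟W y)

reward≡parikh : ∀ {k nQ n} (R : Fin nQ → Subset k) (qs : Vec (Fin nQ) n) →
                reward R qs ≡ parikh (V.map R qs)
reward≡parikh R []       = refl
reward≡parikh R (q ∷ qs) = cong (zipWith ℕ._+_ (toVec01 (R q))) (reward≡parikh R qs)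

runProb-permWord : ∀ {k nS} (π : Permutation′ k) (δ : Fin nS → Subset k → Dist nS) q {n}
                   (x : Word k n) qs →
                   runProb (λ q i → δ q (permSet π i)) q x qs ≡ runProb δ q (permWord π x) qs
runProb-permWord π δ q []      []        = refl
runProb-permWord π δ q (i ∷ x) (q′ ∷ qs) =
  cong (prob (δ q (permSet π i)) q′ *_) (runProb-permWord π δ q′ x qs)

module _ {k : ℕ} (π : Permutation′ k) where

  lookup-permVec : ∀ (a : Vec ℕ k) m → lookup (permVec π a) m ≡ lookup a (π ⟨$⟩ˡ m)
  lookup-permVec a m = lookup∘tabulate (λ m → lookup a (π ⟨$⟩ˡ m)) m

  permVec-injective : ∀ {a b : Vec ℕ k} → permVec π a ≡ permVec π b → a ≡ b
  permVec-injective {a} {b} eq = Pointwise-≡⇒≡ (ext λ j → begin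
    lookup a j                       ≡⟨ cong (lookup a) (inverseˡ π) ⟨
    lookup a (π ⟨$⟩ˡ (π ⟨$⟩ʳ j))     ≡⟨ lookup-permVec a (π ⟨$⟩ʳ j) ⟨
    lookup (permVec π a) (π ⟨$⟩ʳ j)  ≡⟨ cong (λ w → lookup w (π ⟨$⟩ʳ j)) eq ⟩
    lookup (permVec π b) (π ⟨$⟩ʳ j)  ≡⟨ lookup-permVec b (π ⟨$⟩ʳ j) ⟩
    lookup b (π ⟨$⟩ˡ (π ⟨$⟩ʳ j))     ≡⟨ cong (lookup b) (inverseˡ π) ⟩
    lookup b j                       ∎)

  permVec-zipWith-+ : ∀ (u v : Vec ℕ k) →
    permVec π (zipWith ℕ._+_ u v) ≡ zipWith ℕ._+_ (permVec π u) (permVec π v)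
  permVec-zipWith-+ u v = Pointwise-≡⇒≡ (ext λ m → begin
    lookup (permVec π (zipWith ℕ._+_ u v)) m
      ≡⟨ lookup-permVec (zipWith ℕ._+_ u v) m ⟩
    lookup (zipWith ℕ._+_ u v) (π ⟨$⟩ˡ m)
      ≡⟨ lookup-zipWith ℕ._+_ (π ⟨$⟩ˡ m) u v ⟩
    lookup u (π ⟨$⟩ˡ m) ℕ.+ lookup v (π ⟨$⟩ˡ m)
      ≡⟨ cong₂ ℕ._+_ (lookup-permVec u m) (lookup-permVec v m) ⟨
    lookup (permVec π u) m ℕ.+ lookup (permVec π v) m
      ≡⟨ lookup-zipWith ℕ._+_ m (permVec π u) (permVec π v) ⟨
    lookup (zipWith ℕ._+_ (permVec π u) (permVec π v)) m ∎)

  permVec-replicate : ∀ (c : ℕ) → permVec π (replicate k c) ≡ replicate k c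
  permVec-replicate c = Pointwise-≡⇒≡ (ext λ m →
    trans (lookup-permVec (replicate k c) m)
          (trans (lookup-replicate (π ⟨$⟩ˡ m) c) (sym (lookup-replicate m c))))

  unpermSet : Subset k → Subset k
  unpermSet s = tabulate (λ j → lookup s (π ⟨$⟩ʳ j))

  permVec-toVec01-unpermSet : ∀ s → permVec π (toVec01 (unpermSet s)) ≡ toVec01 s
  permVec-toVec01-unpermSet s = Pointwise-≡⇒≡ (ext λ m → begin
    lookup (permVec π (toVec01 (unpermSet s))) m
      ≡⟨ lookup-permVec (toVec01 (unpermSet s)) m ⟩
    lookup (toVec01 (unpermSet s)) (π ⟨$⟩ˡ m)
      ≡⟨ lookup-map (π ⟨$⟩ˡ m) bit (unpermSet s) ⟩
    bit (lookup (unpermSet s) (π ⟨$⟩ˡ m))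
      ≡⟨ cong bit (lookup∘tabulate (λ j → lookup s (π ⟨$⟩ʳ j)) (π ⟨$⟩ˡ m)) ⟩
    bit (lookup s (π ⟨$⟩ʳ (π ⟨$⟩ˡ m)))
      ≡⟨ cong (λ j → bit (lookup s j)) (inverseʳ π) ⟩
    bit (lookup s m)
      ≡⟨ lookup-map m bit s ⟨
    lookup (toVec01 s) m ∎)
    where
    bit : Bool → ℕ
    bit b = 𝔹.if b then 1 else 0

  permVec-reward-unpermSet : ∀ {nQ n} (ℓ : Fin nQ → Subset k) (qs : Vec (Fin nQ) n) →
    permVec π (reward (λ q → unpermSet (ℓ q)) qs) ≡ parikh (V.map ℓ qs)
  permVec-reward-unpermSet ℓ []       = permVec-replicate 0
  permVec-reward-unpermSet ℓ (q ∷ qs) =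
    trans (permVec-zipWith-+ (toVec01 (unpermSet (ℓ q))) (reward (λ q → unpermSet (ℓ q)) qs))
          (cong₂ (zipWith ℕ._+_) (permVec-toVec01-unpermSet (ℓ q)) (permVec-reward-unpermSet ℓ qs))

module _ {k : ℕ} (T : Transducer k) where
  open Transducer T

  parikhPRA : PRA k
  parikhPRA = record { nQ = nS ; δ = δ ; q₀ = s₀ ; F = ⊥ ; R = ℓ }

  permutedParikhPRA : Permutation′ k → PRA k
  permutedParikhPRA π = record
    { nQ = nS ; δ = λ q i → δ q (permSet π i) ; q₀ = s₀ ; F = ⊥ ; R = λ q → unpermSet π (ℓ q) }

  PrReward-parikhPRA : ∀ {n} (x : Word k n) a → PrReward parikhPRA x a ≡ PrParikh T x a
  PrReward-parikhPRA {n} x a = begin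
    PrReward parikhPRA x a
      ≡⟨ ∑-cong (allVec (allFin nS) n)
           (λ qs → cong (λ r → runProb δ s₀ x qs * indicator (r ≟ℕv a)) (reward≡parikh ℓ qs)) ⟩
    ∑[ qs ∈ allVec (allFin nS) n ] (runProb δ s₀ x qs * indicator (parikh (V.map ℓ qs) ≟ℕv a))
      ≡⟨ PrParikh≡∑-runs T x a ⟨
    PrParikh T x a ∎

  PrReward-permutedParikhPRA : ∀ π {n} (x : Word k n) a →
    PrReward (permutedParikhPRA π) x a ≡ PrParikh T (permWord π x) (permVec π a)
  PrReward-permutedParikhPRA π {n} x a = begin
    PrReward (permutedParikhPRA π) x a
      ≡⟨ ∑-cong (allVec (allFin nS) n)
           (λ qs → cong₂ (λ p b → p * indicator b) (runProb-permWord π δ s₀ x qs) (rewardTest qs)) ⟩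
    ∑[ qs ∈ allVec (allFin nS) n ]
      (runProb δ s₀ (permWord π x) qs * indicator (parikh (V.map ℓ qs) ≟ℕv permVec π a))
      ≡⟨ PrParikh≡∑-runs T (permWord π x) (permVec π a) ⟨
    PrParikh T (permWord π x) (permVec π a) ∎
    where
    r : Vec (Fin nS) n → Vec ℕ k
    r = reward (λ q → unpermSet π (ℓ q))

    rewardTest : ∀ qs → r qs ≟ℕv a ≡ parikh (V.map ℓ qs) ≟ℕv permVec π a
    rewardTest qs = begin
      ⌊ ≡-dec ℕ._≟_ (r qs) a ⌋
        ≡⟨ isYes≗does (≡-dec ℕ._≟_ (r qs) a) ⟩
      does (≡-dec ℕ._≟_ (r qs) a)
        ≡⟨ does-⇔ (mk⇔ (cong (permVec π)) (permVec-injective π))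
                 (≡-dec ℕ._≟_ (r qs) a) (≡-dec ℕ._≟_ (permVec π (r qs)) (permVec π a)) ⟩
      does (≡-dec ℕ._≟_ (permVec π (r qs)) (permVec π a))
        ≡⟨ isYes≗does (≡-dec ℕ._≟_ (permVec π (r qs)) (permVec π a)) ⟨
      permVec π (r qs) ≟ℕv permVec π a
        ≡⟨ cong (_≟ℕv permVec π a) (permVec-reward-unpermSet π ℓ qs) ⟩
      parikh (V.map ℓ qs) ≟ℕv permVec π a ∎

lemma11 : {k : ℕ} (T : Transducer k) (π : Permutation′ k) →
    Σ (PRA k) λ A → Σ (PRA k) λ B →
      ((m : ℕ) (x : Word k (suc m)) (a : Vec ℕ k) →
        (PrReward A x a ≡ PrParikh T x a)
        × (PrReward B x a ≡ PrParikh T (permWord π x) (permVec π a)))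
lemma11 T π =
  parikhPRA T , permutedParikhPRA T π ,
  λ m x a → PrReward-parikhPRA T x a , PrReward-permutedParikhPRA T π x a
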